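{- Let $\mathbb{F}$ be a field with $\operatorname{char}(\mathbb{F}) \neq 2$, $n \geq 3$, $1 \leq k \leq n-1$, and let $C = (c_{ij}) \in \operatorname{Mat}_n(\mathbb{F})$ be a matrix all of whose entries are nonzero such that $C \circ A \in \Lambda^{\leq k}$ for every $A \in \Lambda^{\leq k}$. Then there exist nonzero $d_{1,1}, \dots, d_{1,n}, d_{2,1}, \dots, d_{2,n} \in \mathbb{F}$ such that $c_{ij} = d_{1,i}d_{2,j}$ for all $i,j\in[n]$.
   Context: $\operatorname{prk}(A)$ is the size of the largest square submatrix of $A$ with nonzero permanent; $\Lambda^{\leq k} = \{A \in \operatorname{Mat}_n(\mathbb{F}) : \operatorname{prk}(A) \leq k\}$. $\circ$ denotes the Hadamard (entrywise) product. -}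

module Defs where

open import Level using (Level; _⊔_)
open import Data.Nat using (ℕ; zero; suc; _≤_; _<_)
open import Data.Fin using (Fin; zero; suc; punchIn; toℕ)
open import Data.Product using (Σ; _×_; _,_)
open import Relation.Nullary using (¬_)
open import Algebra.Bundles using (CommutativeRing)

record Field (c ℓ : Level) : Set (Level.suc (c ⊔ ℓ)) where
  field
    commutativeRing : CommutativeRing c ℓ
  open CommutativeRing commutativeRing public
  field
    1≉0     : ¬ (1# ≈ 0#)
    inverse : ∀ x → ¬ (x ≈ 0#) → Σ Carrier (λ y → x * y ≈ 1#)

module FieldMatrices {c ℓ : Level} (F : Field c ℓ) where
  open Field F using (Carrier; _≈_; _+_; _*_; 0#; 1#)

  Mat : ℕ → ℕ → Set c
  Mat m n = Fin m → Fin n → Carrier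

  sumFin : ∀ {n} → (Fin n → Carrier) → Carrier
  sumFin {zero}  f = 0#
  sumFin {suc n} f = f zero + sumFin (λ i → f (suc i))

  -- This equals Σ_{σ ∈ S_m} Π_i A_{i,σ(i)}; per of the 0 × 0 matrix is 1.
  per : ∀ {m} → Mat m m → Carrier
  per {zero}  A = 1#
  per {suc m} A = sumFin (λ j → A zero j * per (λ i i' → A (suc i) (punchIn j i')))

  StrictlyIncreasing : ∀ {m n} → (Fin m → Fin n) → Set
  StrictlyIncreasing {m} r = ∀ (i j : Fin m) → toℕ i < toℕ j → toℕ (r i) < toℕ (r j)

  submatrix : ∀ {m n} → Mat n n → (Fin m → Fin n) → (Fin m → Fin n) → Mat m m
  submatrix A r s i j = A (r i) (s j)

  -- prk(A) ≤ k : every square submatrix of size m > k has zero permanent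
  -- (equivalently, the largest square submatrix with nonzero permanent has size ≤ k)
  PrkAtMost : ∀ {n} → ℕ → Mat n n → Set ℓ
  PrkAtMost {n} k A =
    ∀ (m : ℕ) → k < m → (r s : Fin m → Fin n) →
      StrictlyIncreasing r → StrictlyIncreasing s →
      per (submatrix A r s) ≈ 0#

  _∘ₕ_ : ∀ {n} → Mat n n → Mat n n → Mat n n
  (C ∘ₕ A) i j = C i j * A i j

{-# OPTIONS --safe #-}
-- Fix i, j ≠ 0. The matrix A is the 2 × 2 block [[1, 1], [1, -1]] on rows {0, i} and columns
-- {0, j}, completed by k - 1 further ones at positions (e t, f t) which, together with the block,
-- fill a (k + 1) × (k + 1) submatrix with increasing rows and columns. Expanding permanents along
-- the rows of these ones shows prk A ≤ k, because the block itself has permanent 1·(-1) + 1·1 = 0.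
-- Hence prk (C ∘ A) ≤ k, so the permanent of that submatrix of C ∘ A vanishes; expanding it along
-- the same ones, whose weights C (e t) (f t) are nonzero, leaves C₀ⱼ Cᵢ₀ - C₀₀ Cᵢⱼ = 0. So every
-- 2 × 2 minor of C through the entry (0, 0) vanishes, and C i j = C i 0 · (C 0 j / C 0 0).
module Submission where

open import Defs
open import Level using (Level)
open import Data.Nat using (ℕ; _≤_; _∸_)
open import Data.Fin using (Fin)
open import Data.Product using (Σ; _×_; _,_)
open import Relation.Nullary using (¬_)

open import Level using (_⊔_)
open import Data.Nat as ℕ using (zero; suc; z≤n; s≤s)
import Data.Nat.Properties as ℕₚ
open import Data.Fin as Fin using (zero; suc; punchIn; punchOut; toℕ; inject≤; fromℕ; fromℕ<; _≟_)
open import Data.Fin.Properties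
  using ( punchIn-injective; punchInᵢ≢i; punchIn-punchOut; punchIn-mono-≤; any?; 0≢1+n; suc-injective
        ; toℕ-injective; toℕ-inject≤; toℕ-fromℕ<; toℕ-fromℕ; toℕ<n )
open import Data.Product using (∃; proj₁; proj₂)
open import Data.Sum using (_⊎_; inj₁; inj₂)
open import Data.Empty using (⊥-elim)
open import Function using (_∘_)
open import Function.Definitions using (Injective)
import Algebra.Properties.CommutativeSemigroup as CommutativeSemigroupProperties
open import Relation.Nullary using (Dec; yes; no)
open import Relation.Nullary.Decidable using (_⊎-dec_; ¬?; decidable-stable)
open import Relation.Binary.PropositionalEquality as ≡ using (_≡_; _≢_)
open import Relation.Binary.Definitions using (tri<; tri≈; tri>)

private
  variable
    m n L : ℕ

_∈Im_ : Fin n → (Fin m → Fin n) → Set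
u ∈Im r = ∃ λ p → r p ≡ u

∈Im-punchIn : {r : Fin (suc m) → Fin n} {u : Fin n} (x : Fin (suc m)) →
              u ∈Im r → r x ≢ u → u ∈Im (r ∘ punchIn x)
∈Im-punchIn {r = r} x (p , rp≡u) rx≢u = punchOut x≢p , ≡.trans (≡.cong r (punchIn-punchOut x≢p)) rp≡u
  where
  x≢p : x ≢ p
  x≢p x≡p = rx≢u (≡.trans (≡.cong r x≡p) rp≡u)

punchIn-punchIn-comm : ∀ (b : Fin (suc (suc m))) j (b≢j : punchIn b j ≢ b) k →
                       punchIn (punchIn b j) (punchIn (punchOut b≢j) k) ≡ punchIn b (punchIn j k)
punchIn-punchIn-comm         zero    j       _   k       = ≡.refl
punchIn-punchIn-comm         (suc b) zero    _   k       = ≡.refl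
punchIn-punchIn-comm {suc m} (suc b) (suc j) _   zero    = ≡.refl
punchIn-punchIn-comm {suc m} (suc b) (suc j) b≢j (suc k) = ≡.cong suc (punchIn-punchIn-comm b j _ k)

punchIn-mono-< : ∀ (x : Fin (suc m)) i j → toℕ i ℕ.< toℕ j → toℕ (punchIn x i) ℕ.< toℕ (punchIn x j)
punchIn-mono-< x i j i<j = ℕₚ.≤∧≢⇒< (punchIn-mono-≤ x i j (ℕₚ.<⇒≤ i<j))
  (λ eq → ℕₚ.<⇒≢ i<j (≡.cong toℕ (punchIn-injective x i j (toℕ-injective eq))))

SamePair : Fin n → Fin n → Fin n → Fin n → Set
SamePair x₀ x₁ u v = (x₀ ≡ u × x₁ ≡ v) ⊎ (x₀ ≡ v × x₁ ≡ u)

samePair-∈Im : (r : Fin 2 → Fin n) {u v : Fin n} → u ∈Im r → v ∈Im r → u ≢ v →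
               SamePair (r zero) (r (suc zero)) u v
samePair-∈Im r (zero     , p) (zero     , q) u≢v = ⊥-elim (u≢v (≡.trans (≡.sym p) q))
samePair-∈Im r (zero     , p) (suc zero , q) _   = inj₁ (p , q)
samePair-∈Im r (suc zero , p) (zero     , q) _   = inj₂ (q , p)
samePair-∈Im r (suc zero , p) (suc zero , q) u≢v = ⊥-elim (u≢v (≡.trans (≡.sym p) q))

samePair-∈pair : {x₀ x₁ u v : Fin n} → x₀ ≡ u ⊎ x₀ ≡ v → x₁ ≡ u ⊎ x₁ ≡ v → x₀ ≢ x₁ →
                 SamePair x₀ x₁ u v
samePair-∈pair (inj₁ p) (inj₁ q) x₀≢x₁ = ⊥-elim (x₀≢x₁ (≡.trans p (≡.sym q)))
samePair-∈pair (inj₁ p) (inj₂ q) _     = inj₁ (p , q)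
samePair-∈pair (inj₂ p) (inj₁ q) _     = inj₂ (p , q)
samePair-∈pair (inj₂ p) (inj₂ q) x₀≢x₁ = ⊥-elim (x₀≢x₁ (≡.trans p (≡.sym q)))

samePair-covers : {x₀ x₁ u v y : Fin n} → SamePair x₀ x₁ u v → y ≡ u ⊎ y ≡ v → y ≡ x₀ ⊎ y ≡ x₁
samePair-covers (inj₁ (≡.refl , ≡.refl)) y∈        = y∈
samePair-covers (inj₂ (≡.refl , ≡.refl)) (inj₁ y≡u) = inj₂ y≡u
samePair-covers (inj₂ (≡.refl , ≡.refl)) (inj₂ y≡v) = inj₁ y≡v

pair-pigeonhole : (r : Fin (3 ℕ.+ m) → Fin n) {u v : Fin n} → Injective _≡_ _≡_ r →
                  ¬ (∀ x → r x ≡ u ⊎ r x ≡ v)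
pair-pigeonhole r r-inj r∈
  with samePair-covers (samePair-∈pair (r∈ zero) (r∈ (suc zero)) (0≢1+n ∘ r-inj)) (r∈ (suc (suc zero)))
... | inj₁ r₂≡r₀ = 0≢1+n (≡.sym (r-inj r₂≡r₀))
... | inj₂ r₂≡r₁ = 0≢1+n (≡.sym (suc-injective (r-inj r₂≡r₁)))

record Avoids (e : Fin L → Fin n) (u v : Fin n) : Set where
  field
    injective : Injective _≡_ _≡_ e
    avoids    : ∀ t → ¬ (e t ≡ u ⊎ e t ≡ v)

avoids-punchIn : {e : Fin (suc L) → Fin n} {u v : Fin n} → Avoids e u v → ∀ t → Avoids (e ∘ punchIn t) u v
avoids-punchIn e-avoids t = record
  { injective = punchIn-injective t _ _ ∘ injective
  ; avoids    = avoids ∘ punchIn t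
  }
  where open Avoids e-avoids

record Covers (r : Fin m → Fin n) (u v : Fin n) (e : Fin L → Fin n) : Set where
  field
    injective : Injective _≡_ _≡_ r
    u∈        : u ∈Im r
    v∈        : v ∈Im r
    e⊆        : ∀ t → e t ∈Im r

covers-punchIn : {r : Fin (suc m) → Fin n} {u v : Fin n} {e : Fin (suc L) → Fin n} {x : Fin (suc m)} {t : Fin (suc L)} →
                 Avoids e u v → Covers r u v e → r x ≡ e t → Covers (r ∘ punchIn x) u v (e ∘ punchIn t)
covers-punchIn {x = x} {t} e-avoids r-covers rx≡et = record
  { injective = punchIn-injective x _ _ ∘ injective
  ; u∈        = ∈Im-punchIn x u∈ (λ rx≡u → Avoids.avoids e-avoids t (inj₁ (≡.trans (≡.sym rx≡et) rx≡u)))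
  ; v∈        = ∈Im-punchIn x v∈ (λ rx≡v → Avoids.avoids e-avoids t (inj₂ (≡.trans (≡.sym rx≡et) rx≡v)))
  ; e⊆        = λ t′ → ∈Im-punchIn x (e⊆ (punchIn t t′))
                  (λ rx≡et′ → punchInᵢ≢i t t′ (Avoids.injective e-avoids (≡.trans (≡.sym rx≡et′) rx≡et)))
  }
  where open Covers r-covers

module Complement {r : Fin (2 ℕ.+ L) → Fin n} (r-inj : Injective _≡_ _≡_ r)
                  {u v : Fin n} (u∈r : u ∈Im r) (v∈r : v ∈Im r) (u≢v : u ≢ v) where
  private
    p q : Fin (2 ℕ.+ L)
    p = proj₁ u∈r
    q = proj₁ v∈r
    p≢q : p ≢ q
    p≢q p≡q = u≢v (≡.trans (≡.sym (proj₂ u∈r)) (≡.trans (≡.cong r p≡q) (proj₂ v∈r)))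
    q′ : Fin (suc L)
    q′ = punchOut p≢q

  rest : Fin L → Fin n
  rest t = r (punchIn p (punchIn q′ t))

  rest-avoids : Avoids rest u v
  rest-avoids = record
    { injective = punchIn-injective q′ _ _ ∘ punchIn-injective p _ _ ∘ r-inj
    ; avoids    = λ t → λ
        { (inj₁ rest≡u) → punchInᵢ≢i p _ (r-inj (≡.trans rest≡u (≡.sym (proj₂ u∈r))))
        ; (inj₂ rest≡v) → punchInᵢ≢i q′ t (punchIn-injective p _ _ (r-inj
            (≡.trans rest≡v (≡.trans (≡.sym (proj₂ v∈r)) (≡.cong r (≡.sym (punchIn-punchOut p≢q)))))))
        }
    }

  rest-covered : Covers r u v rest
  rest-covered = record { injective = r-inj ; u∈ = u∈r ; v∈ = v∈r ; e⊆ = λ t → _ , ≡.refl }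

module _ {c ℓ} (F : Field c ℓ) where
  open Field F hiding (zero)
  open FieldMatrices F
  open import Relation.Binary.Reasoning.Setoid setoid
  open import Algebra.Properties.Ring ring using (-‿distribʳ-*)
  open import Algebra.Properties.Group +-group using (x∙y⁻¹≈ε⇒x≈y; ε⁻¹≈ε)
  module +-Comm = CommutativeSemigroupProperties +-commutativeSemigroup
  module *-Comm = CommutativeSemigroupProperties *-commutativeSemigroup

  x*y≈0⇒y≈0 : ∀ {x y} → ¬ (x ≈ 0#) → x * y ≈ 0# → y ≈ 0#
  x*y≈0⇒y≈0 {x} {y} x≉0 xy≈0 with inverse x x≉0
  ... | x⁻¹ , xx⁻¹≈1 = begin
    y               ≈⟨ *-identityˡ y ⟨
    1# * y          ≈⟨ *-congʳ (trans (*-comm x⁻¹ x) xx⁻¹≈1) ⟨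
    x⁻¹ * x * y     ≈⟨ *-assoc x⁻¹ x y ⟩
    x⁻¹ * (x * y)   ≈⟨ *-congˡ xy≈0 ⟩
    x⁻¹ * 0#        ≈⟨ zeroʳ x⁻¹ ⟩
    0#              ∎

  *-≉0 : ∀ {x y} → ¬ (x ≈ 0#) → ¬ (y ≈ 0#) → ¬ (x * y ≈ 0#)
  *-≉0 x≉0 y≉0 = y≉0 ∘ x*y≈0⇒y≈0 x≉0

  sumFin-cong : {f g : Fin m → Carrier} → (∀ i → f i ≈ g i) → sumFin f ≈ sumFin g
  sumFin-cong {zero}  f≈g = refl
  sumFin-cong {suc m} f≈g = +-cong (f≈g zero) (sumFin-cong (f≈g ∘ suc))

  sumFin-≈0 : (f : Fin m → Carrier) → (∀ i → f i ≈ 0#) → sumFin f ≈ 0#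
  sumFin-≈0 {zero}  f f≈0 = refl
  sumFin-≈0 {suc m} f f≈0 = trans (+-cong (f≈0 zero) (sumFin-≈0 (f ∘ suc) (f≈0 ∘ suc))) (+-identityˡ 0#)

  sumFin-*ˡ : ∀ x (f : Fin m → Carrier) → sumFin (λ i → x * f i) ≈ x * sumFin f
  sumFin-*ˡ {zero}  x f = sym (zeroʳ x)
  sumFin-*ˡ {suc m} x f = trans (+-congˡ (sumFin-*ˡ x (f ∘ suc))) (sym (distribˡ x _ _))

  sumFin-punchIn : (f : Fin (suc m) → Carrier) (b : Fin (suc m)) → sumFin f ≈ f b + sumFin (f ∘ punchIn b)
  sumFin-punchIn         f zero    = refl
  sumFin-punchIn {suc m} f (suc b) = trans (+-congˡ (sumFin-punchIn (f ∘ suc) b)) (+-Comm.x∙yz≈y∙xz _ _ _)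

  sumFin-single : (f : Fin (suc m) → Carrier) (b : Fin (suc m)) → (∀ j → j ≢ b → f j ≈ 0#) → sumFin f ≈ f b
  sumFin-single f b f≈0 = begin
    sumFin f                        ≈⟨ sumFin-punchIn f b ⟩
    f b + sumFin (f ∘ punchIn b)    ≈⟨ +-congˡ (sumFin-≈0 (f ∘ punchIn b) (λ j → f≈0 _ (punchInᵢ≢i b j))) ⟩
    f b + 0#                        ≈⟨ +-identityʳ (f b) ⟩
    f b                             ∎

  minor : Mat (suc m) (suc m) → Fin (suc m) → Fin (suc m) → Mat m m
  minor M a b i j = M (punchIn a i) (punchIn b j)

  per-cong : {M N : Mat m m} → (∀ i j → M i j ≈ N i j) → per M ≈ per N
  per-cong {zero}  M≈N = refl
  per-cong {suc m} M≈N =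
    sumFin-cong (λ j → *-cong (M≈N zero j) (per-cong (λ i i′ → M≈N (suc i) (punchIn j i′))))

  per-zeroRow : (M : Mat m m) (a : Fin m) → (∀ j → M a j ≈ 0#) → per M ≈ 0#
  per-zeroRow {suc m} M zero    row≈0 =
    sumFin-≈0 (λ j → M zero j * per (minor M zero j)) (λ j → trans (*-congʳ (row≈0 j)) (zeroˡ _))
  per-zeroRow {suc m} M (suc a) row≈0 =
    sumFin-≈0 (λ j → M zero j * per (minor M zero j))
      (λ j → trans (*-congˡ (per-zeroRow (minor M zero j) a (row≈0 ∘ punchIn j))) (zeroʳ _))

  -- For a row a ≠ 0, expand along row 0: the term of column b has a minor with a zero row, and
  -- the minor of every other column is expanded along row a recursively.
  per-expandRow : (M : Mat (suc m) (suc m)) (a b : Fin (suc m)) → (∀ j → j ≢ b → M a j ≈ 0#) →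
                  per M ≈ M a b * per (minor M a b)
  per-expandRow M zero b row≈0 =
    sumFin-single (λ j → M zero j * per (minor M zero j)) b (λ j j≢b → trans (*-congʳ (row≈0 j j≢b)) (zeroˡ _))
  per-expandRow {suc m} M (suc a) b row≈0 = begin
    sumFin term                               ≈⟨ sumFin-punchIn term b ⟩
    term b + sumFin (term ∘ punchIn b)        ≈⟨ +-cong term-b≈0 (sumFin-cong {f = term ∘ punchIn b} term-punchIn) ⟩
    0# + sumFin (λ j → M (suc a) b * term′ j) ≈⟨ +-identityˡ _ ⟩
    sumFin (λ j → M (suc a) b * term′ j)      ≈⟨ sumFin-*ˡ (M (suc a) b) term′ ⟩
    M (suc a) b * sumFin term′                ∎
    where
    term : Fin (suc (suc m)) → Carrier
    term j = M zero j * per (minor M zero j)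
    term′ : Fin (suc m) → Carrier
    term′ j = M zero (punchIn b j) * per (minor (minor M (suc a) b) zero j)
    term-b≈0 : term b ≈ 0#
    term-b≈0 = trans (*-congˡ (per-zeroRow (minor M zero b) a (λ j → row≈0 _ (punchInᵢ≢i b j)))) (zeroʳ _)
    minor-expandRow : ∀ j → per (minor M zero (punchIn b j)) ≈ M (suc a) b * per (minor (minor M (suc a) b) zero j)
    minor-expandRow j = begin
      per (minor M zero (punchIn b j))
        ≈⟨ per-expandRow (minor M zero (punchIn b j)) a b′ off-b′ ⟩
      M (suc a) (punchIn (punchIn b j) b′) * per (minor (minor M zero (punchIn b j)) a b′)
        ≈⟨ *-cong (reflexive (≡.cong (M (suc a)) (punchIn-punchOut b≢j)))
                  (per-cong (λ i k → reflexive (≡.cong (M (suc (punchIn a i))) (punchIn-punchIn-comm b j b≢j k)))) ⟩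
      M (suc a) b * per (minor (minor M (suc a) b) zero j)
        ∎
      where
      b≢j : punchIn b j ≢ b
      b≢j = punchInᵢ≢i b j
      b′ : Fin (suc m)
      b′ = punchOut b≢j
      off-b′ : ∀ k → k ≢ b′ → M (suc a) (punchIn (punchIn b j) k) ≈ 0#
      off-b′ k k≢b′ = row≈0 _ (λ eq → k≢b′ (punchIn-injective (punchIn b j) k b′
                                            (≡.trans eq (≡.sym (punchIn-punchOut b≢j)))))
    term-punchIn : ∀ j → term (punchIn b j) ≈ M (suc a) b * term′ j
    term-punchIn j = trans (*-congˡ (minor-expandRow j)) (*-Comm.x∙yz≈y∙xz _ _ _)

  per₂ : Mat n n → Fin n → Fin n → Fin n → Fin n → Carrier
  per₂ M u v y z = M u y * M v z + M u z * M v y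

  per-2×2 : (M : Mat 2 2) → per M ≈ per₂ M zero (suc zero) zero (suc zero)
  per-2×2 M = +-cong (*-congˡ per-1×1) (trans (+-identityʳ _) (*-congˡ per-1×1))
    where
    per-1×1 : ∀ {x} → x * 1# + 0# ≈ x
    per-1×1 = trans (+-identityʳ _) (*-identityʳ _)

  per₂-cong : (M N : Mat n n) → (∀ x y → M x y ≈ N x y) → ∀ u v y z → per₂ M u v y z ≈ per₂ N u v y z
  per₂-cong M N M≈N u v y z = +-cong (*-cong (M≈N u y) (M≈N v z)) (*-cong (M≈N u z) (M≈N v y))

  per₂-rows : (M : Mat n n) {x₀ x₁ u v : Fin n} → SamePair x₀ x₁ u v →
              ∀ y z → per₂ M x₀ x₁ y z ≈ per₂ M u v y z
  per₂-rows M (inj₁ (≡.refl , ≡.refl)) y z = refl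
  per₂-rows M (inj₂ (≡.refl , ≡.refl)) y z = trans (+-cong (*-comm _ _) (*-comm _ _)) (+-comm _ _)

  per₂-cols : (M : Mat n n) {y₀ y₁ y z : Fin n} → SamePair y₀ y₁ y z →
              ∀ u v → per₂ M u v y₀ y₁ ≈ per₂ M u v y z
  per₂-cols M (inj₁ (≡.refl , ≡.refl)) u v = refl
  per₂-cols M (inj₂ (≡.refl , ≡.refl)) u v = +-comm _ _

  per₂-zeroCol : (M : Mat n n) (u v y z : Fin n) → (∀ x → M x y ≈ 0#) → per₂ M u v y z ≈ 0#
  per₂-zeroCol M u v y z col≈0 =
    trans (+-cong (trans (*-congʳ (col≈0 u)) (zeroˡ _)) (trans (*-congˡ (col≈0 v)) (zeroʳ _))) (+-identityˡ 0#)

  δ : Fin n → Fin n → Carrier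
  δ x y with x ≟ y
  ... | yes _ = 1#
  ... | no  _ = 0#

  δ-≡ : {x y : Fin n} → x ≡ y → δ x y ≈ 1#
  δ-≡ {x = x} ≡.refl with x ≟ x
  ... | yes _   = refl
  ... | no  x≢x = ⊥-elim (x≢x ≡.refl)

  δ-refl : (x : Fin n) → δ x x ≈ 1#
  δ-refl x = δ-≡ {x = x} ≡.refl

  δ-≢ : {x y : Fin n} → x ≢ y → δ x y ≈ 0#
  δ-≢ {x = x} {y} x≢y with x ≟ y
  ... | yes x≡y = ⊥-elim (x≢y x≡y)
  ... | no  _   = refl

  ones : Mat n n
  ones _ _ = 1#

  per-ones-∘ₕ : (A : Mat n n) (r s : Fin m → Fin n) → per (submatrix (ones ∘ₕ A) r s) ≈ per (submatrix A r s)
  per-ones-∘ₕ A r s = per-cong {M = submatrix (ones ∘ₕ A) r s} {N = submatrix A r s} (λ _ _ → *-identityˡ _)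

  _+ᴹ_ : Mat n n → Mat n n → Mat n n
  (A +ᴹ B) x y = A x y + B x y

  partialPerm : (Fin L → Fin n) → (Fin L → Fin n) → Mat n n
  partialPerm e f x y = sumFin (λ t → δ (e t) x * δ (f t) y)

  partialPerm-row : (e f : Fin (suc L) → Fin n) → Injective _≡_ _≡_ e →
                    ∀ t y → partialPerm e f (e t) y ≈ δ (f t) y
  partialPerm-row {L = L} e f e-inj t y = begin
    sumFin g                     ≈⟨ sumFin-single g t (λ t′ t′≢t → trans (*-congʳ (δ-≢ (t′≢t ∘ e-inj))) (zeroˡ _)) ⟩
    δ (e t) (e t) * δ (f t) y    ≈⟨ *-congʳ (δ-refl (e t)) ⟩
    1# * δ (f t) y               ≈⟨ *-identityˡ _ ⟩
    δ (f t) y                    ∎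
    where
    g : Fin (suc L) → Carrier
    g t′ = δ (e t′) (e t) * δ (f t′) y

  partialPerm-offRows : (e f : Fin L → Fin n) {x : Fin n} → (∀ t → e t ≢ x) →
                        ∀ y → partialPerm e f x y ≈ 0#
  partialPerm-offRows e f {x} e≢x y =
    sumFin-≈0 (λ t → δ (e t) x * δ (f t) y) (λ t → trans (*-congʳ (δ-≢ (e≢x t))) (zeroˡ _))

  partialPerm-punchIn : (e f : Fin (suc L) → Fin n) (t : Fin (suc L)) {x : Fin n} → e t ≢ x →
                        ∀ y → partialPerm e f x y ≈ partialPerm (e ∘ punchIn t) (f ∘ punchIn t) x y
  partialPerm-punchIn {L = L} e f t {x} et≢x y = begin
    sumFin g                       ≈⟨ sumFin-punchIn g t ⟩
    g t + sumFin (g ∘ punchIn t)   ≈⟨ +-congʳ (trans (*-congʳ (δ-≢ et≢x)) (zeroˡ _)) ⟩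
    0# + sumFin (g ∘ punchIn t)    ≈⟨ +-identityˡ _ ⟩
    sumFin (g ∘ punchIn t)         ∎
    where
    g : Fin (suc L) → Carrier
    g t′ = δ (e t′) x * δ (f t′) y

  +partialPerm-row : (B : Mat n n) (e f : Fin (suc L) → Fin n) →
                     Injective _≡_ _≡_ e → (∀ t y → B (e t) y ≈ 0#) →
                     ∀ {x t} → x ≡ e t → ∀ y → (B +ᴹ partialPerm e f) x y ≈ δ (f t) y
  +partialPerm-row B e f e-inj B-e≈0 {t = t} ≡.refl y =
    trans (+-cong (B-e≈0 t y) (partialPerm-row e f e-inj t y)) (+-identityˡ _)

  +partialPerm-offRows : (B : Mat n n) (e f : Fin L → Fin n) {x : Fin n} → (∀ t → e t ≢ x) →
                         ∀ y → (B +ᴹ partialPerm e f) x y ≈ B x y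
  +partialPerm-offRows B e f e≢x y = trans (+-congˡ (partialPerm-offRows e f e≢x y)) (+-identityʳ _)

  per-expand-partialPerm :
    (W B : Mat n n) (e f : Fin (suc L) → Fin n) → Injective _≡_ _≡_ e → (∀ t y → B (e t) y ≈ 0#) →
    {r s : Fin (suc m) → Fin n} → Injective _≡_ _≡_ r → Injective _≡_ _≡_ s →
    ∀ {x y t} → r x ≡ e t → s y ≡ f t →
    per (submatrix (W ∘ₕ (B +ᴹ partialPerm e f)) r s)
      ≈ W (e t) (f t) * per (submatrix (W ∘ₕ (B +ᴹ partialPerm (e ∘ punchIn t) (f ∘ punchIn t)))
                                       (r ∘ punchIn x) (s ∘ punchIn y))
  per-expand-partialPerm {n = n} {m = m} W B e f e-inj B-e≈0 {r} {s} r-inj s-inj {x} {y} {t} rx≡et sy≡ft =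
    trans (per-expandRow M x y off-pivot) (*-cong pivot (per-cong (λ i j → *-congˡ (other-rows i _))))
    where
    A : Mat n n
    A = B +ᴹ partialPerm e f
    M : Mat (suc m) (suc m)
    M = submatrix (W ∘ₕ A) r s
    off-pivot : ∀ j → j ≢ y → M x j ≈ 0#
    off-pivot j j≢y =
      trans (*-congˡ (trans (+partialPerm-row B e f e-inj B-e≈0 rx≡et (s j)) (δ-≢ ft≢sj))) (zeroʳ _)
      where
      ft≢sj : f t ≢ s j
      ft≢sj ft≡sj = j≢y (s-inj (≡.trans (≡.sym ft≡sj) (≡.sym sy≡ft)))
    pivot : M x y ≈ W (e t) (f t)
    pivot = trans (*-cong (reflexive (≡.cong₂ W rx≡et sy≡ft))
                          (trans (+partialPerm-row B e f e-inj B-e≈0 rx≡et (s y)) (δ-≡ (≡.sym sy≡ft))))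
                  (*-identityʳ _)
    other-rows : ∀ i c →
                 A (r (punchIn x i)) c ≈ (B +ᴹ partialPerm (e ∘ punchIn t) (f ∘ punchIn t)) (r (punchIn x i)) c
    other-rows i = +-congˡ ∘ partialPerm-punchIn e f t
      (λ et≡r → punchInᵢ≢i x i (r-inj (≡.trans (≡.sym et≡r) (≡.sym rx≡et))))

  increasing⇒injective : {r : Fin m → Fin n} → StrictlyIncreasing r → Injective _≡_ _≡_ r
  increasing⇒injective {r = r} r↑ {x} {y} rx≡ry with ℕₚ.<-cmp (toℕ x) (toℕ y)
  ... | tri< x<y _ _ = ⊥-elim (ℕₚ.<-irrefl (≡.cong toℕ rx≡ry) (r↑ x y x<y))
  ... | tri≈ _ x≡y _ = toℕ-injective x≡y
  ... | tri> _ _ y<x = ⊥-elim (ℕₚ.<-irrefl (≡.cong toℕ (≡.sym rx≡ry)) (r↑ y x y<x))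

  increasing-∘punchIn : {r : Fin (suc m) → Fin n} → StrictlyIncreasing r →
                        ∀ x → StrictlyIncreasing (r ∘ punchIn x)
  increasing-∘punchIn r↑ x i j i<j = r↑ _ _ (punchIn-mono-< x i j i<j)

  prk-+partialPerm : ∀ {k} (B : Mat n n) (e f : Fin L → Fin n) →
                     Injective _≡_ _≡_ e → (∀ t y → B (e t) y ≈ 0#) →
                     PrkAtMost k B → PrkAtMost (k ℕ.+ L) (B +ᴹ partialPerm e f)
  prk-+partialPerm {L = L} {k = k} B e f e-inj B-e≈0 prkB m k+L<m r s r↑ s↑
    with any? (λ x → any? (λ t → r x ≟ e t))
  ... | no r∌e =
    trans (per-cong (λ i j → +partialPerm-offRows B e f (λ t et≡r → r∌e (i , t , ≡.sym et≡r)) (s j)))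
          (prkB m (ℕₚ.≤-<-trans (ℕₚ.m≤m+n k L) k+L<m) r s r↑ s↑)
  prk-+partialPerm {n = n} {L = suc L} {k = k} B e f e-inj B-e≈0 prkB (suc m) k+L<m r s r↑ s↑
    | yes (x , t , rx≡et) with any? (λ y → s y ≟ f t)
  ... | no s∌ft = per-zeroRow (submatrix (B +ᴹ partialPerm e f) r s) x (λ j →
          trans (+partialPerm-row B e f e-inj B-e≈0 rx≡et (s j)) (δ-≢ (λ ft≡sj → s∌ft (j , ≡.sym ft≡sj))))
  ... | yes (y , sy≡ft) = begin
    per (submatrix A r s)                   ≈⟨ per-ones-∘ₕ A r s ⟨
    per (submatrix (ones ∘ₕ A) r s)
      ≈⟨ per-expand-partialPerm ones B e f e-inj B-e≈0
           (increasing⇒injective r↑) (increasing⇒injective s↑) rx≡et sy≡ft ⟩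
    1# * per (submatrix (ones ∘ₕ A′) r′ s′) ≈⟨ *-identityˡ _ ⟩
    per (submatrix (ones ∘ₕ A′) r′ s′)      ≈⟨ per-ones-∘ₕ A′ r′ s′ ⟩
    per (submatrix A′ r′ s′)
      ≈⟨ prk-+partialPerm B (e ∘ punchIn t) (f ∘ punchIn t) (punchIn-injective t _ _ ∘ e-inj) (B-e≈0 ∘ punchIn t)
                          prkB m (≡.subst (ℕ._≤ m) (ℕₚ.+-suc k L) (ℕₚ.≤-pred k+L<m))
                          r′ s′ (increasing-∘punchIn r↑ x) (increasing-∘punchIn s↑ y) ⟩
    0#                                      ∎
    where
    A A′ : Mat n n
    A = B +ᴹ partialPerm e f
    A′ = B +ᴹ partialPerm (e ∘ punchIn t) (f ∘ punchIn t)
    r′ s′ : Fin m → Fin n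
    r′ = r ∘ punchIn x
    s′ = s ∘ punchIn y

  record Selection (K n : ℕ) (i : Fin (suc n)) : Set where
    field
      indices    : Fin (suc K) → Fin (suc n)
      increasing : StrictlyIncreasing indices
      zero∈      : zero ∈Im indices
      target∈    : i ∈Im indices

  module _ {K n : ℕ} (K<n : suc K ≤ n) (i : Fin (suc n)) where
    private
      2+K≤1+n : suc (suc K) ≤ suc n
      2+K≤1+n = s≤s K<n

    prefixThen : Fin (suc (suc K)) → Fin (suc n)
    prefixThen x with toℕ x ℕ.<? suc K
    ... | yes _ = inject≤ x 2+K≤1+n
    ... | no  _ = i

    toℕ-prefixThen-< : ∀ x → toℕ x ℕ.< suc K → toℕ (prefixThen x) ≡ toℕ x
    toℕ-prefixThen-< x x<K with toℕ x ℕ.<? suc K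
    ... | yes _   = toℕ-inject≤ x 2+K≤1+n
    ... | no  x≮K = ⊥-elim (x≮K x<K)

    prefixThen-≮ : ∀ x → ¬ (toℕ x ℕ.< suc K) → prefixThen x ≡ i
    prefixThen-≮ x x≮K with toℕ x ℕ.<? suc K
    ... | yes x<K = ⊥-elim (x≮K x<K)
    ... | no  _   = ≡.refl

    prefixThen-increasing : suc K ℕ.< toℕ i → StrictlyIncreasing prefixThen
    prefixThen-increasing K<i x y x<y = by-cases (toℕ y ℕ.<? suc K)
      where
      x<K : toℕ x ℕ.< suc K
      x<K = ℕₚ.<-≤-trans x<y (ℕₚ.≤-pred (toℕ<n y))
      by-cases : Dec (toℕ y ℕ.< suc K) → toℕ (prefixThen x) ℕ.< toℕ (prefixThen y)
      by-cases (yes y<K) = ≡.subst₂ ℕ._<_ (≡.sym (toℕ-prefixThen-< x x<K)) (≡.sym (toℕ-prefixThen-< y y<K)) x<y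
      by-cases (no  y≮K) =
        ≡.subst₂ ℕ._<_ (≡.sym (toℕ-prefixThen-< x x<K)) (≡.cong toℕ (≡.sym (prefixThen-≮ y y≮K))) (ℕₚ.<-trans x<K K<i)

    select : Selection (suc K) n i
    select with toℕ i ℕ.≤? suc K
    ... | yes i≤K = record
      { indices    = λ x → inject≤ x 2+K≤1+n
      ; increasing = λ x y → ≡.subst₂ ℕ._<_ (≡.sym (toℕ-inject≤ x _)) (≡.sym (toℕ-inject≤ y _))
      ; zero∈      = zero , ≡.refl
      ; target∈    = fromℕ< (s≤s i≤K) , toℕ-injective (≡.trans (toℕ-inject≤ _ _) (toℕ-fromℕ< (s≤s i≤K)))
      }
    ... | no i≰K = record
      { indices    = prefixThen
      ; increasing = prefixThen-increasing (ℕₚ.≰⇒> i≰K)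
      ; zero∈      = zero , toℕ-injective (toℕ-prefixThen-< zero (s≤s z≤n))
      ; target∈    = fromℕ (suc K) , prefixThen-≮ (fromℕ (suc K)) (ℕₚ.<-irrefl (toℕ-fromℕ (suc K)))
      }

  module TestMatrix {a a′ b b′ : Fin n} (a≢a′ : a ≢ a′) (b≢b′ : b ≢ b′) where

    -- The matrix [[1, 1], [1, -1]] on rows a, a′ and columns b, b′.
    block : Mat n n
    block x y = δ x a * (δ y b + δ y b′) + δ x a′ * (δ y b - δ y b′)

    block-row-a : ∀ y → block a y ≈ δ y b + δ y b′
    block-row-a y =
      trans (+-cong (trans (*-congʳ (δ-refl a)) (*-identityˡ _)) (trans (*-congʳ (δ-≢ a≢a′)) (zeroˡ _)))
            (+-identityʳ _)

    block-row-a′ : ∀ y → block a′ y ≈ δ y b - δ y b′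
    block-row-a′ y =
      trans (+-cong (trans (*-congʳ (δ-≢ (a≢a′ ∘ ≡.sym))) (zeroˡ _)) (trans (*-congʳ (δ-refl a′)) (*-identityˡ _)))
            (+-identityˡ _)

    block-offRows : ∀ {x} → ¬ (x ≡ a ⊎ x ≡ a′) → ∀ y → block x y ≈ 0#
    block-offRows x∉ y =
      trans (+-cong (trans (*-congʳ (δ-≢ (x∉ ∘ inj₁))) (zeroˡ _)) (trans (*-congʳ (δ-≢ (x∉ ∘ inj₂))) (zeroˡ _)))
            (+-identityˡ 0#)

    block-offCols : ∀ {y} → ¬ (y ≡ b ⊎ y ≡ b′) → ∀ x → block x y ≈ 0#
    block-offCols {y} y∉ x =
      trans (+-cong (trans (*-congˡ sum≈0) (zeroʳ _)) (trans (*-congˡ difference≈0) (zeroʳ _))) (+-identityˡ 0#)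
      where
      δyb≈0 : δ y b ≈ 0#
      δyb≈0 = δ-≢ (y∉ ∘ inj₁)
      δyb′≈0 : δ y b′ ≈ 0#
      δyb′≈0 = δ-≢ (y∉ ∘ inj₂)
      sum≈0 : δ y b + δ y b′ ≈ 0#
      sum≈0 = trans (+-cong δyb≈0 δyb′≈0) (+-identityˡ 0#)
      difference≈0 : δ y b - δ y b′ ≈ 0#
      difference≈0 = trans (+-congʳ (trans δyb≈0 (sym δyb′≈0))) (-‿inverseʳ _)

    block-ab : block a b ≈ 1#
    block-ab = trans (block-row-a b) (trans (+-cong (δ-refl b) (δ-≢ b≢b′)) (+-identityʳ 1#))

    block-ab′ : block a b′ ≈ 1#
    block-ab′ = trans (block-row-a b′) (trans (+-cong (δ-≢ (b≢b′ ∘ ≡.sym)) (δ-refl b′)) (+-identityˡ 1#))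

    block-a′b : block a′ b ≈ 1#
    block-a′b = trans (block-row-a′ b) (trans (+-cong (δ-refl b) (trans (-‿cong (δ-≢ b≢b′)) ε⁻¹≈ε)) (+-identityʳ 1#))

    block-a′b′ : block a′ b′ ≈ - 1#
    block-a′b′ = trans (block-row-a′ b′) (trans (+-cong (δ-≢ (b≢b′ ∘ ≡.sym)) (-‿cong (δ-refl b′))) (+-identityˡ _))

    per₂-block : per₂ block a a′ b b′ ≈ 0#
    per₂-block = begin
      block a b * block a′ b′ + block a b′ * block a′ b
        ≈⟨ +-cong (*-cong block-ab block-a′b′) (*-cong block-ab′ block-a′b) ⟩
      1# * - 1# + 1# * 1#    ≈⟨ +-cong (*-identityˡ _) (*-identityˡ _) ⟩
      - 1# + 1#              ≈⟨ -‿inverseˡ 1# ⟩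
      0#                     ∎

    per₂-∘ₕ-block : (W : Mat n n) → per₂ (W ∘ₕ block) a a′ b b′ ≈ W a b′ * W a′ b - W a b * W a′ b′
    per₂-∘ₕ-block W = begin
      W a b * block a b * (W a′ b′ * block a′ b′) + W a b′ * block a b′ * (W a′ b * block a′ b)
        ≈⟨ +-cong (*-cong (*-congˡ block-ab) (*-congˡ block-a′b′))
                  (*-cong (*-congˡ block-ab′) (*-congˡ block-a′b)) ⟩
      W a b * 1# * (W a′ b′ * - 1#) + W a b′ * 1# * (W a′ b * 1#)
        ≈⟨ +-cong (*-cong (*-identityʳ _) (trans (sym (-‿distribʳ-* _ _)) (-‿cong (*-identityʳ _))))
                  (*-cong (*-identityʳ _) (*-identityʳ _)) ⟩
      W a b * - (W a′ b′) + W a b′ * W a′ b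
        ≈⟨ +-congʳ (-‿distribʳ-* _ _) ⟨
      - (W a b * W a′ b′) + W a b′ * W a′ b
        ≈⟨ +-comm _ _ ⟩
      W a b′ * W a′ b - W a b * W a′ b′
        ∎

    per₂-block-cols : ∀ {y z} → y ≢ z → per₂ block a a′ y z ≈ 0#
    per₂-block-cols {y} {z} y≢z with y ≟ b ⊎-dec y ≟ b′ | z ≟ b ⊎-dec z ≟ b′
    ... | no  y∉ | _      = per₂-zeroCol block a a′ y z (block-offCols y∉)
    ... | yes _  | no z∉  = trans (+-comm _ _) (per₂-zeroCol block a a′ z y (block-offCols z∉))
    ... | yes y∈ | yes z∈ = trans (per₂-cols block (samePair-∈pair y∈ z∈ y≢z) a a′) per₂-block

    per-block-rowsInPair : (r s : Fin (2 ℕ.+ m) → Fin n) → Injective _≡_ _≡_ r → Injective _≡_ _≡_ s →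
                           (∀ x → r x ≡ a ⊎ r x ≡ a′) → per (submatrix block r s) ≈ 0#
    per-block-rowsInPair {zero} r s r-inj s-inj r∈ = begin
      per (submatrix block r s)                                  ≈⟨ per-2×2 (submatrix block r s) ⟩
      per₂ block (r zero) (r (suc zero)) (s zero) (s (suc zero))
        ≈⟨ per₂-rows block (samePair-∈pair (r∈ zero) (r∈ (suc zero)) (0≢1+n ∘ r-inj)) (s zero) (s (suc zero)) ⟩
      per₂ block a a′ (s zero) (s (suc zero))                    ≈⟨ per₂-block-cols (0≢1+n ∘ s-inj) ⟩
      0#                                                         ∎
    per-block-rowsInPair {suc m} r s r-inj s-inj r∈ = ⊥-elim (pair-pigeonhole r r-inj r∈)

    block-prk≤1 : PrkAtMost 1 block
    block-prk≤1 (suc (suc m)) (s≤s (s≤s z≤n)) r s r↑ s↑ with any? (λ x → ¬? (r x ≟ a ⊎-dec r x ≟ a′))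
    ... | yes (x , rx∉) = per-zeroRow (submatrix block r s) x (block-offRows rx∉ ∘ s)
    ... | no  r⊈        = per-block-rowsInPair r s (increasing⇒injective r↑) (increasing⇒injective s↑)
                            (λ x → decidable-stable (r x ≟ a ⊎-dec r x ≟ a′) (r⊈ ∘ (x ,_)))

    testMatrix : (e f : Fin L → Fin n) → Mat n n
    testMatrix e f = block +ᴹ partialPerm e f

    testMatrix-prk : {e : Fin L → Fin n} → Avoids e a a′ → (f : Fin L → Fin n) → PrkAtMost (suc L) (testMatrix e f)
    testMatrix-prk {e = e} e-avoids f = prk-+partialPerm block e f injective (block-offRows ∘ avoids) block-prk≤1
      where open Avoids e-avoids

    per-∘ₕ-testMatrix≈0⇒per₂-∘ₕ-block≈0 :
      {e f : Fin L → Fin n} → Avoids e a a′ → Avoids f b b′ → (W : Mat n n) → (∀ x y → ¬ (W x y ≈ 0#)) →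
      {r s : Fin (2 ℕ.+ L) → Fin n} → Covers r a a′ e → Covers s b b′ f →
      per (submatrix (W ∘ₕ testMatrix e f) r s) ≈ 0# → per₂ (W ∘ₕ block) a a′ b b′ ≈ 0#
    per-∘ₕ-testMatrix≈0⇒per₂-∘ₕ-block≈0 {zero} {e} {f} _ _ W _ {r} {s} r-covers s-covers per≈0 = begin
      per₂ (W ∘ₕ block) a a′ b b′
        ≈⟨ per₂-cong M (W ∘ₕ block) (λ x y → *-congˡ (+-identityʳ _)) a a′ b b′ ⟨
      per₂ M a a′ b b′
        ≈⟨ per₂-rows M (samePair-∈Im r (Covers.u∈ r-covers) (Covers.v∈ r-covers) a≢a′) _ _ ⟨
      per₂ M (r zero) (r (suc zero)) b b′
        ≈⟨ per₂-cols M (samePair-∈Im s (Covers.u∈ s-covers) (Covers.v∈ s-covers) b≢b′) _ _ ⟨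
      per₂ M (r zero) (r (suc zero)) (s zero) (s (suc zero))
        ≈⟨ per-2×2 (submatrix M r s) ⟨
      per (submatrix M r s)
        ≈⟨ per≈0 ⟩
      0# ∎
      where
      M : Mat n n
      M = W ∘ₕ testMatrix e f
    per-∘ₕ-testMatrix≈0⇒per₂-∘ₕ-block≈0 {suc L} {e} {f} e-avoids f-avoids W W≉0 r-covers s-covers per≈0
      with Covers.e⊆ r-covers zero | Covers.e⊆ s-covers zero
    ... | x , rx≡e₀ | y , sy≡f₀ =
      per-∘ₕ-testMatrix≈0⇒per₂-∘ₕ-block≈0 (avoids-punchIn e-avoids zero) (avoids-punchIn f-avoids zero) W W≉0
        (covers-punchIn e-avoids r-covers rx≡e₀) (covers-punchIn f-avoids s-covers sy≡f₀)
        (x*y≈0⇒y≈0 (W≉0 (e zero) (f zero)) (trans (sym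
          (per-expand-partialPerm W block e f (Avoids.injective e-avoids) (block-offRows ∘ Avoids.avoids e-avoids)
                                  (Covers.injective r-covers) (Covers.injective s-covers) rx≡e₀ sy≡f₀))
          per≈0))

  cross-relation : ∀ {k} → suc k ≤ n → (C : Mat (suc n) (suc n)) → (∀ i j → ¬ (C i j ≈ 0#)) →
                   (∀ A → PrkAtMost (suc k) A → PrkAtMost (suc k) (C ∘ₕ A)) →
                   ∀ i j → C zero zero * C i j ≈ C zero j * C i zero
  cross-relation k<n C C≉0 preserves i j with i ≟ zero | j ≟ zero
  ... | yes ≡.refl | _          = *-comm _ _
  ... | no _       | yes ≡.refl = refl
  cross-relation {n = n} {k = k} k<n C C≉0 preserves i j | no i≢0 | no j≢0 =
    sym (x∙y⁻¹≈ε⇒x≈y _ _ (trans (sym (per₂-∘ₕ-block C)) per₂≈0))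
    where
    open TestMatrix (i≢0 ∘ ≡.sym) (j≢0 ∘ ≡.sym)
    module Rows = Selection (select k<n i)
    module Cols = Selection (select k<n j)
    module OtherRows = Complement (increasing⇒injective Rows.increasing) Rows.zero∈ Rows.target∈ (i≢0 ∘ ≡.sym)
    module OtherCols = Complement (increasing⇒injective Cols.increasing) Cols.zero∈ Cols.target∈ (j≢0 ∘ ≡.sym)
    A : Mat (suc n) (suc n)
    A = testMatrix OtherRows.rest OtherCols.rest
    per≈0 : per (submatrix (C ∘ₕ A) Rows.indices Cols.indices) ≈ 0#
    per≈0 = preserves A (testMatrix-prk OtherRows.rest-avoids OtherCols.rest)
                      (suc (suc k)) ℕₚ.≤-refl Rows.indices Cols.indices Rows.increasing Cols.increasing
    per₂≈0 : per₂ (C ∘ₕ block) zero i zero j ≈ 0#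
    per₂≈0 = per-∘ₕ-testMatrix≈0⇒per₂-∘ₕ-block≈0 OtherRows.rest-avoids OtherCols.rest-avoids C C≉0
               OtherRows.rest-covered OtherCols.rest-covered per≈0

  IsOuterProduct : Mat n n → Set (c ⊔ ℓ)
  IsOuterProduct {n} C = Σ (Fin n → Carrier) (λ d₁ → Σ (Fin n → Carrier) (λ d₂ →
    (∀ i → ¬ (d₁ i ≈ 0#)) × (∀ j → ¬ (d₂ j ≈ 0#)) × (∀ i j → C i j ≈ d₁ i * d₂ j)))

  cross-relation⇒isOuterProduct : (C : Mat (suc n) (suc n)) → (∀ i j → ¬ (C i j ≈ 0#)) →
                                  (∀ i j → C zero zero * C i j ≈ C zero j * C i zero) → IsOuterProduct C
  cross-relation⇒isOuterProduct C C≉0 cross with inverse (C zero zero) (C≉0 zero zero)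
  ... | z⁻¹ , zz⁻¹≈1 =
    (λ i → C i zero) , (λ j → C zero j * z⁻¹) ,
    (λ i → C≉0 i zero) , (λ j → *-≉0 (C≉0 zero j) z⁻¹≉0) , entry
    where
    z : Carrier
    z = C zero zero
    z⁻¹≉0 : ¬ (z⁻¹ ≈ 0#)
    z⁻¹≉0 z⁻¹≈0 = 1≉0 (trans (sym zz⁻¹≈1) (trans (*-congˡ z⁻¹≈0) (zeroʳ z)))
    entry : ∀ i j → C i j ≈ C i zero * (C zero j * z⁻¹)
    entry i j = begin
      C i j                       ≈⟨ *-identityˡ _ ⟨
      1# * C i j                  ≈⟨ *-congʳ (trans (*-comm z⁻¹ z) zz⁻¹≈1) ⟨
      z⁻¹ * z * C i j             ≈⟨ *-assoc _ _ _ ⟩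
      z⁻¹ * (z * C i j)           ≈⟨ *-congˡ (cross i j) ⟩
      z⁻¹ * (C zero j * C i zero) ≈⟨ *-Comm.x∙yz≈z∙yx _ _ _ ⟩
      C i zero * (C zero j * z⁻¹) ∎

lemma5p3 : ∀ {c ℓ} (F : Field c ℓ) → let open Field F in let open FieldMatrices F in
    ¬ (1# + 1# ≈ 0#) →
    (n k : ℕ) → 3 ≤ n → 1 ≤ k → k ≤ n ∸ 1 →
    (C : Mat n n) → (∀ i j → ¬ (C i j ≈ 0#)) →
    (∀ (A : Mat n n) → PrkAtMost k A → PrkAtMost k (C ∘ₕ A)) →
    Σ (Fin n → Carrier) (λ d₁ → Σ (Fin n → Carrier) (λ d₂ →
      (∀ i → ¬ (d₁ i ≈ 0#)) × (∀ j → ¬ (d₂ j ≈ 0#)) ×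
      (∀ i j → C i j ≈ d₁ i * d₂ j)))
lemma5p3 F _ zero    _       ()
lemma5p3 F _ (suc n) zero    _  ()
lemma5p3 F _ (suc n) (suc k) _  _  k<n C C≉0 preserves =
  cross-relation⇒isOuterProduct F C C≉0 (cross-relation F k<n C C≉0 preserves)
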